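{- Let $N=\{1,\ldots,n\}$ and let $\nu_1,\nu_2$ be normalized capacities on $N$. Let $v:\mathcal{Q}(N)\to\mathbb{R}$ be the bi-capacity defined by $v(A,B)=\nu_1(A)-\nu_2(B)$ for all $(A,B)\in\mathcal{Q}(N)$. Then the M\"obius transform $m$ of $v$ satisfies: \begin{itemize} \item $m(A,N\setminus A)=m^{\nu_1}(A)$ for all $A\subseteq N$, $A\neq\emptyset$; \item $m(\emptyset,B)=m^{\overline{\nu_2}}(N\setminus B)$ for all $B\subsetneq N$; \item $m(\emptyset,N)=-1$; \item $m(A,B)=0$ for all $(A,B)\in\mathcal{Q}(N)$ with $A\neq\emptyset$ and $B\neq N\setminus A$. \end{itemize}
   Context: $\mathcal{Q}(N)=\{(A,B)\in 2^N\times 2^N : A\cap B=\emptyset\}$, ordered by $(A,B)\sqsubseteq(C,D)$ iff $A\subseteq C$ and $B\supseteq D$. A normalized capacity on $N$ is a set function $\nu:2^N\to\mathbb{R}$ with $\nu(\emptyset)=0$, $\nu(N)=1$ and $A\subseteq B\Rightarrow\nu(A)\leq\nu(B)$. Its conjugate is $\overline{\nu}(A)=1-\nu(N\setminus A)$, and its M\"obius transform is $m^{\nu}(A)=\sum_{B\subseteq A}(-1)^{|A\setminus B|}\nu(B)$. The M\"obius transform of a function $v:\mathcal{Q}(N)\to\mathbb{R}$ is the unique function $m:\mathcal{Q}(N)\to\mathbb{R}$ such that $v(A,A')=\sum_{(B,B')\sqsubseteq(A,A')}m(B,B')$ for all $(A,A')\in\mathcal{Q}(N)$. -}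

module Defs where

open import Level using (Level; _⊔_)
open import Data.Nat using (ℕ; zero; suc)
open import Data.Bool using (Bool; true; false; if_then_else_; _∧_)
import Data.Bool.Properties as BoolP
open import Data.Vec using ([]; _∷_)
open import Data.Vec.Properties using (≡-dec)
open import Data.List using (List; []; _∷_; map; _++_)
open import Data.Product using (_×_; _,_)
open import Data.Fin.Subset using (Subset; outside; inside; _⊆_; _⊇_; _∩_; _─_; ∁; ∣_∣; ⊥; ⊤)
open import Data.Fin.Subset.Properties using (_⊆?_)
open import Relation.Nullary using (Dec; yes; no; does)
open import Relation.Binary.PropositionalEquality using (_≡_)
open import Algebra.Bundles using (CommutativeRing)

subsets : (n : ℕ) → List (Subset n)
subsets zero = [] ∷ []
subsets (suc n) = map (outside ∷_) (subsets n) ++ map (inside ∷_) (subsets n)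

-- (A , B) ∈ Q(N) iff A ∩ B = ∅.
Disjoint : {n : ℕ} → Subset n → Subset n → Set
Disjoint A B = A ∩ B ≡ ⊥

disjoint? : {n : ℕ} (A B : Subset n) → Dec (Disjoint A B)
disjoint? A B = ≡-dec BoolP._≟_ (A ∩ B) ⊥

_⊑_ : {n : ℕ} → Subset n × Subset n → Subset n × Subset n → Set
(A , B) ⊑ (C , D) = (A ⊆ C) × (B ⊇ D)

module _ {c ℓ : Level} (R : CommutativeRing c ℓ) where
  open CommutativeRing R

  sumL : {X : Set} → List X → (X → Carrier) → Carrier
  sumL [] f = 0#
  sumL (x ∷ xs) f = f x + sumL xs f

  sign : ℕ → Carrier
  sign zero = 1#
  sign (suc k) = - sign k

  record IsCapacity {n : ℕ} {ℓ' : Level} (_≤_ : Carrier → Carrier → Set ℓ')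
                    (ν : Subset n → Carrier) : Set (ℓ ⊔ ℓ') where
    field
      empty     : ν ⊥ ≈ 0#
      full      : ν ⊤ ≈ 1#
      monotone  : ∀ {A B} → A ⊆ B → ν A ≤ ν B

  conjugate : {n : ℕ} → (Subset n → Carrier) → Subset n → Carrier
  conjugate ν A = 1# - ν (∁ A)

  mobius : {n : ℕ} → (Subset n → Carrier) → Subset n → Carrier
  mobius {n} ν A = sumL (subsets n) (λ B → if does (B ⊆? A) then sign ∣ A ─ B ∣ * ν B else 0#)

  sumBelow : {n : ℕ} → (Subset n → Subset n → Carrier) → Subset n → Subset n → Carrier
  sumBelow {n} m A A' =
    sumL (subsets n) (λ B → sumL (subsets n) (λ B' →
      if does (disjoint? B B') ∧ does (B ⊆? A) ∧ does (A' ⊆? B')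
      then m B B' else 0#))

  -- m is the Möbius transform of v : Q(N) → R, i.e.
  -- v(A,A') = Σ_{(B,B') ⊑ (A,A')} m(B,B') for all (A,A') ∈ Q(N).
  -- (Such m is unique on Q(N); values of m off Q(N) are irrelevant.)
  IsBiMobius : {n : ℕ} → (Subset n → Subset n → Carrier) → (Subset n → Subset n → Carrier) → Set ℓ
  IsBiMobius v m = ∀ A A' → Disjoint A A' → v A A' ≈ sumBelow m A A'

module Submission where

-- Identify a pair (A , B) ∈ Q(N) with the map N → {in B, in neither, in A}.
-- On every coordinate these three statuses form a chain (in B < neither <
-- in A), and ⊑ is the product order, so Q(N) is a product of n 3-element
-- chains.  Hence the Möbius transform of any v : Q(N) → R is obtained by
-- taking, coordinate after coordinate, the difference with the predecessor
-- status; this is the explicit function biMobius below.  We show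
--   (1) every Möbius transform m of v agrees with biMobius v on Q(N)
--       (peeling off the first coordinate of sumBelow), and
--   (2) biMobius is additive; for a function of A alone it lives on the
--       pairs (A , ∁ A), with value m^α(A), and for a function of B alone
--       it lives on the pairs (∅ , B), with value m^{β∘∁}(∁ B).
-- The proposition then follows by splitting v into ν₁(A) and -ν₂(B), using
-- that the Möbius transform of ν̄₂ = 1 - ν₂∘∁ ignores the constant 1 on
-- nonempty sets and that ν₁(∅) = 0, ν₂(N) = 1.

open import Defs
open import Level using (Level)
open import Function using (_∘_)
open import Data.Nat using (ℕ; zero; suc)
open import Data.Fin.Subset using (Subset; ∁; ⊥; ⊤; outside; inside)
open import Data.Fin.Subset.Properties using (_⊆?_; ∩-inverseʳ; ∩-zeroˡ)
open import Data.Product using (_×_; _,_)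
open import Data.Bool using (Bool; true; false; if_then_else_; _∧_; not)
open import Data.Bool.Properties using (∧-zeroʳ; not-involutive)
open import Data.Vec using ([]; _∷_; head; tail)
open import Data.Vec.Properties using (map-∘; map-cong; map-id; map-replicate)
open import Data.List using (List; []; _∷_; _++_)
import Data.List as List
open import Relation.Nullary using (¬_; does; contradiction)
open import Relation.Binary.PropositionalEquality as P using (_≡_)
open import Algebra.Bundles using (CommutativeRing)
import Relation.Binary.Reasoning.Setoid as SetoidReasoning

∁⊥≡⊤ : (n : ℕ) → ∁ (⊥ {n}) ≡ ⊤
∁⊥≡⊤ n = map-replicate not outside n

∁⊤≡⊥ : (n : ℕ) → ∁ (⊤ {n}) ≡ ⊥
∁⊤≡⊥ n = map-replicate not inside n

∁-involutive : {n : ℕ} (A : Subset n) → ∁ (∁ A) ≡ A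
∁-involutive A = P.trans (P.sym (map-∘ not not A)) (P.trans (map-cong not-involutive A) (map-id A))

module BiMobius {c ℓ : Level} (R : CommutativeRing c ℓ) where
  open CommutativeRing R
  open import Algebra.Properties.Ring ring using (-‿distribˡ-*; -‿distribʳ-*)
  open import Algebra.Properties.AbelianGroup +-abelianGroup
    using (⁻¹-∙-comm; xyx⁻¹≈y; //-rightDividesʳ)
  open import Algebra.Properties.CommutativeSemigroup +-commutativeSemigroup
    using (interchange)
  open SetoidReasoning setoid

  -‿cong₂ : ∀ {a a' b b'} → a ≈ a' → b ≈ b' → a - b ≈ a' - b'
  -‿cong₂ p q = +-cong p (-‿cong q)

  -‿interchange : ∀ a b c d → (a + b) - (c + d) ≈ (a - c) + (b - d)
  -‿interchange a b c d = trans (+-congˡ (sym (⁻¹-∙-comm c d))) (interchange a b (- c) (- d))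

  -‿cancel-common : ∀ k a b → (k + a) - (k + b) ≈ a - b
  -‿cancel-common k a b = begin
    (k + a) - (k + b)   ≈⟨ -‿interchange k a k b ⟩
    (k - k) + (a - b)   ≈⟨ +-congʳ (-‿inverseʳ k) ⟩
    0# + (a - b)        ≈⟨ +-identityˡ (a - b) ⟩
    a - b               ∎

  -- The two signed terms of a Möbius sum that differ in one element.
  signed-difference : ∀ s a b → (- s) * a + s * b ≈ s * (b - a)
  signed-difference s a b = begin
    (- s) * a + s * b    ≈⟨ +-comm _ _ ⟩
    s * b + (- s) * a    ≈⟨ +-congˡ (sym (-‿distribˡ-* s a)) ⟩
    s * b + - (s * a)    ≈⟨ +-congˡ (-‿distribʳ-* s a) ⟩
    s * b + s * (- a)    ≈⟨ distribˡ s b (- a) ⟨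
    s * (b - a)          ∎

  sumL-cong : {X : Set} (xs : List X) {f g : X → Carrier} →
              (∀ x → f x ≈ g x) → sumL R xs f ≈ sumL R xs g
  sumL-cong []       e = refl
  sumL-cong (x ∷ xs) e = +-cong (e x) (sumL-cong xs e)

  sumL-zero : {X : Set} (xs : List X) {f : X → Carrier} → (∀ x → f x ≈ 0#) → sumL R xs f ≈ 0#
  sumL-zero []       e = refl
  sumL-zero (x ∷ xs) e = trans (+-cong (e x) (sumL-zero xs e)) (+-identityʳ 0#)

  sumL-+ : {X : Set} (xs : List X) (f g : X → Carrier) →
           sumL R xs (λ x → f x + g x) ≈ sumL R xs f + sumL R xs g
  sumL-+ []       f g = sym (+-identityʳ 0#)
  sumL-+ (x ∷ xs) f g = trans (+-congˡ (sumL-+ xs f g)) (interchange _ _ _ _)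

  sumL-++ : {X : Set} (xs ys : List X) (f : X → Carrier) →
            sumL R (xs ++ ys) f ≈ sumL R xs f + sumL R ys f
  sumL-++ []       ys f = sym (+-identityˡ _)
  sumL-++ (x ∷ xs) ys f = trans (+-congˡ (sumL-++ xs ys f)) (sym (+-assoc _ _ _))

  sumL-map : {X Y : Set} (h : X → Y) (xs : List X) (f : Y → Carrier) →
             sumL R (List.map h xs) f ≡ sumL R xs (f ∘ h)
  sumL-map h []       f = P.refl
  sumL-map h (x ∷ xs) f = P.cong (f (h x) +_) (sumL-map h xs f)

  sum-subsets-suc : ∀ n (F : Subset (suc n) → Carrier) →
    sumL R (subsets (suc n)) F ≈
    sumL R (subsets n) (λ B → F (outside ∷ B)) + sumL R (subsets n) (λ B → F (inside ∷ B))
  sum-subsets-suc n F = trans (sumL-++ (List.map (outside ∷_) (subsets n)) _ F)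
    (reflexive (P.cong₂ _+_ (sumL-map (outside ∷_) (subsets n) F) (sumL-map (inside ∷_) (subsets n) F)))

  guard-cong : ∀ b {x y} → x ≈ y → (if b then x else 0#) ≈ (if b then y else 0#)
  guard-cong true  e = e
  guard-cong false e = refl

  guard-+ : ∀ b x y → (if b then x else 0#) + (if b then y else 0#) ≈ (if b then x + y else 0#)
  guard-+ true  x y = refl
  guard-+ false x y = +-identityʳ 0#

  guard-off : ∀ {b} x → b ≡ false → (if b then x else 0#) ≈ 0#
  guard-off x P.refl = refl

  mobius-[] : (ν : Subset 0 → Carrier) → mobius R ν [] ≈ ν []
  mobius-[] ν = trans (+-identityʳ _) (*-identityˡ _)

  mobius-inside : ∀ n (ν : Subset (suc n) → Carrier) A →
    mobius R ν (inside ∷ A) ≈ mobius R (λ B → ν (inside ∷ B) - ν (outside ∷ B)) A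
  mobius-inside n ν A = begin
    mobius R ν (inside ∷ A)
      ≈⟨ sum-subsets-suc n _ ⟩
    sumL R (subsets n) _ + sumL R (subsets n) _
      ≈⟨ sumL-+ (subsets n) _ _ ⟨
    sumL R (subsets n) _
      ≈⟨ sumL-cong (subsets n) (λ B → trans (guard-+ (does (B ⊆? A)) _ _)
                                            (guard-cong (does (B ⊆? A)) (signed-difference _ _ _))) ⟩
    mobius R (λ B → ν (inside ∷ B) - ν (outside ∷ B)) A
      ∎

  mobius-outside : ∀ n (ν : Subset (suc n) → Carrier) A →
    mobius R ν (outside ∷ A) ≈ mobius R (λ B → ν (outside ∷ B)) A
  mobius-outside n ν A = trans (sum-subsets-suc n _)
    (trans (+-congˡ (sumL-zero (subsets n) (λ B → refl))) (+-identityʳ _))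

  mobius-cong : ∀ {n} {f g : Subset n → Carrier} A → (∀ B → f B ≈ g B) → mobius R f A ≈ mobius R g A
  mobius-cong {n} A e = sumL-cong (subsets n) (λ B → guard-cong (does (B ⊆? A)) (*-congˡ (e B)))

  mobius-⊥ : ∀ n (f : Subset n → Carrier) → mobius R f ⊥ ≈ f ⊥
  mobius-⊥ zero    f = mobius-[] f
  mobius-⊥ (suc n) f = trans (mobius-outside n f ⊥) (mobius-⊥ n (f ∘ (outside ∷_)))

  mobius-shift : ∀ n (k : Carrier) (h : Subset n → Carrier) C → ¬ C ≡ ⊥ →
                 mobius R (λ C → k + h C) C ≈ mobius R h C
  mobius-shift zero    k h []            C≢⊥ = contradiction P.refl C≢⊥
  mobius-shift (suc n) k h (inside ∷ C)  C≢⊥ = begin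
    mobius R (λ C → k + h C) (inside ∷ C)
      ≈⟨ mobius-inside n _ C ⟩
    mobius R (λ B → (k + h (inside ∷ B)) - (k + h (outside ∷ B))) C
      ≈⟨ mobius-cong C (λ B → -‿cancel-common k _ _) ⟩
    mobius R (λ B → h (inside ∷ B) - h (outside ∷ B)) C
      ≈⟨ mobius-inside n h C ⟨
    mobius R h (inside ∷ C)
      ∎
  mobius-shift (suc n) k h (outside ∷ C) C≢⊥ = begin
    mobius R (λ C → k + h C) (outside ∷ C)
      ≈⟨ mobius-outside n _ C ⟩
    mobius R (λ C → k + h (outside ∷ C)) C
      ≈⟨ mobius-shift n k (h ∘ (outside ∷_)) C (C≢⊥ ∘ P.cong (outside ∷_)) ⟩
    mobius R (h ∘ (outside ∷_)) C
      ≈⟨ mobius-outside n h C ⟨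
    mobius R h (outside ∷ C)
      ∎

  slice : ∀ {n} → (Subset (suc n) → Subset (suc n) → Carrier) → Bool → Bool →
          Subset n → Subset n → Carrier
  slice f b b' B B' = f (b ∷ B) (b' ∷ B')

  below : ∀ {n} → (Subset n → Subset n → Carrier) → Subset n → Subset n → Subset n → Subset n → Carrier
  below f X Y B B' = if does (disjoint? B B') ∧ does (B ⊆? X) ∧ does (Y ⊆? B') then f B B' else 0#

  quadrant : ∀ {n} → (Subset (suc n) → Subset (suc n) → Carrier) →
             Subset (suc n) → Subset (suc n) → Bool → Bool → Carrier
  quadrant {n} f X Y b b' = sumL R (subsets n) (λ B → sumL R (subsets n) (λ B' → below f X Y (b ∷ B) (b' ∷ B')))

  sumBelow-quadrants : ∀ n (f : Subset (suc n) → Subset (suc n) → Carrier) X Y →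
    sumBelow R f X Y ≈ (quadrant f X Y false false + quadrant f X Y false true)
                     + (quadrant f X Y true false + quadrant f X Y true true)
  sumBelow-quadrants n f X Y = trans (sum-subsets-suc n _) (+-cong (split outside) (split inside))
    where
    split : ∀ b → sumL R (subsets n) (λ B → sumL R (subsets (suc n)) (below f X Y (b ∷ B)))
                  ≈ quadrant f X Y b false + quadrant f X Y b true
    split b = trans (sumL-cong (subsets n) (λ B → sum-subsets-suc n _)) (sumL-+ (subsets n) _ _)

  double-sum-zero : ∀ n {F : Subset n → Subset n → Carrier} → (∀ B B' → F B B' ≈ 0#) →
                    sumL R (subsets n) (λ B → sumL R (subsets n) (F B)) ≈ 0#
  double-sum-zero n e = sumL-zero (subsets n) (λ B → sumL-zero (subsets n) (e B))

  -- Pairs (B , B') with first element in both B and B' are not disjoint.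
  quadrant-overlap : ∀ n (f : Subset (suc n) → Subset (suc n) → Carrier) X Y →
                     quadrant f X Y true true ≈ 0#
  quadrant-overlap n f X Y = double-sum-zero n (λ B B' → refl)

  -- B ⊆ X fails when the first element lies in B but not in X.
  quadrant-⊈ : ∀ n (f : Subset (suc n) → Subset (suc n) → Carrier) A Y b' →
               quadrant f (outside ∷ A) Y true b' ≈ 0#
  quadrant-⊈ n f A Y b' = double-sum-zero n (λ B B' →
    guard-off (f (inside ∷ B) (b' ∷ B')) (∧-zeroʳ (does (disjoint? (inside ∷ B) (b' ∷ B')))))

  -- Y ⊆ B' fails when the first element lies in Y but not in B'.
  quadrant-⊉ : ∀ n (f : Subset (suc n) → Subset (suc n) → Carrier) X A' b →
               quadrant f X (inside ∷ A') b false ≈ 0#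
  quadrant-⊉ n f X A' b = double-sum-zero n (λ B B' →
    guard-off (f (b ∷ B) (outside ∷ B'))
      (P.trans (P.cong (does (disjoint? (b ∷ B) (outside ∷ B')) ∧_) (∧-zeroʳ (does ((b ∷ B) ⊆? X))))
               (∧-zeroʳ (does (disjoint? (b ∷ B) (outside ∷ B'))))))

  sumBelow-in₂ : ∀ n (f : Subset (suc n) → Subset (suc n) → Carrier) A A' →
    sumBelow R f (outside ∷ A) (inside ∷ A') ≈ sumBelow R (slice f outside inside) A A'
  sumBelow-in₂ n f A A' = begin
    sumBelow R f (outside ∷ A) (inside ∷ A')
      ≈⟨ sumBelow-quadrants n f (outside ∷ A) (inside ∷ A') ⟩
    (Q false false + Q false true) + (Q true false + Q true true)
      ≈⟨ +-cong (+-congʳ (quadrant-⊉ n f (outside ∷ A) A' false))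
                (+-cong (quadrant-⊈ n f A (inside ∷ A') false) (quadrant-overlap n f (outside ∷ A) (inside ∷ A'))) ⟩
    (0# + Q false true) + (0# + 0#)
      ≈⟨ trans (+-cong (+-identityˡ _) (+-identityʳ 0#)) (+-identityʳ _) ⟩
    sumBelow R (slice f outside inside) A A'
      ∎
    where
    Q : Bool → Bool → Carrier
    Q = quadrant f (outside ∷ A) (inside ∷ A')

  sumBelow-neither : ∀ n (f : Subset (suc n) → Subset (suc n) → Carrier) A A' →
    sumBelow R f (outside ∷ A) (outside ∷ A') ≈
    sumBelow R (slice f outside outside) A A' + sumBelow R (slice f outside inside) A A'
  sumBelow-neither n f A A' =
    trans (sumBelow-quadrants n f (outside ∷ A) (outside ∷ A'))
      (trans (+-congˡ (trans (+-cong (quadrant-⊈ n f A (outside ∷ A') false)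
                                     (quadrant-overlap n f (outside ∷ A) (outside ∷ A')))
                             (+-identityʳ 0#)))
             (+-identityʳ _))

  sumBelow-in₁ : ∀ n (f : Subset (suc n) → Subset (suc n) → Carrier) A A' →
    sumBelow R f (inside ∷ A) (outside ∷ A') ≈
    (sumBelow R (slice f outside outside) A A' + sumBelow R (slice f outside inside) A A')
      + sumBelow R (slice f inside outside) A A'
  sumBelow-in₁ n f A A' =
    trans (sumBelow-quadrants n f (inside ∷ A) (outside ∷ A'))
          (+-congˡ (trans (+-congˡ (quadrant-overlap n f (inside ∷ A) (outside ∷ A'))) (+-identityʳ _)))

  -- Difference along the first coordinate with the predecessor status
  -- (in B < neither < in A); the status "in both" does not occur in Q(N).
  firstDifference : ∀ {n} → (Subset (suc n) → Subset (suc n) → Carrier) → Bool → Bool →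
                    Subset n → Subset n → Carrier
  firstDifference g inside  outside A B = g (inside ∷ A) (outside ∷ B) - g (outside ∷ A) (outside ∷ B)
  firstDifference g outside outside A B = g (outside ∷ A) (outside ∷ B) - g (outside ∷ A) (inside ∷ B)
  firstDifference g outside inside  A B = g (outside ∷ A) (inside ∷ B)
  firstDifference g inside  inside  A B = 0#

  biMobius : ∀ {n} → (Subset n → Subset n → Carrier) → Subset n → Subset n → Carrier
  biMobius g []       []        = g [] []
  biMobius g (b ∷ A)  (b' ∷ B)  = biMobius (firstDifference g b b') A B

  -- For admissible b, b' the intersection
  -- (b ∷ A) ∩ (b' ∷ A') computes to outside ∷ (A ∩ A'), whence disjointness.
  slice-isBiMobius : ∀ {n} {g m : Subset (suc n) → Subset (suc n) → Carrier} →
    IsBiMobius R g m → ∀ b b' → b ∧ b' ≡ false →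
    IsBiMobius R (firstDifference g b b') (slice m b b')
  slice-isBiMobius {n} {g} {m} mob outside inside _ A A' d =
    trans (mob (outside ∷ A) (inside ∷ A') (P.cong (outside ∷_) d)) (sumBelow-in₂ n m A A')
  slice-isBiMobius {n} {g} {m} mob outside outside _ A A' d = begin
    g (outside ∷ A) (outside ∷ A') - g (outside ∷ A) (inside ∷ A')
      ≈⟨ -‿cong₂ (trans (mob (outside ∷ A) (outside ∷ A') (P.cong (outside ∷_) d)) (sumBelow-neither n m A A'))
                 (trans (mob (outside ∷ A) (inside ∷ A') (P.cong (outside ∷_) d)) (sumBelow-in₂ n m A A')) ⟩
    (S outside outside + S outside inside) - S outside inside
      ≈⟨ //-rightDividesʳ _ _ ⟩
    S outside outside
      ∎
    where
    S : Bool → Bool → Carrier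
    S b b' = sumBelow R (slice m b b') A A'
  slice-isBiMobius {n} {g} {m} mob inside outside _ A A' d = begin
    g (inside ∷ A) (outside ∷ A') - g (outside ∷ A) (outside ∷ A')
      ≈⟨ -‿cong₂ (trans (mob (inside ∷ A) (outside ∷ A') (P.cong (outside ∷_) d)) (sumBelow-in₁ n m A A'))
                 (trans (mob (outside ∷ A) (outside ∷ A') (P.cong (outside ∷_) d)) (sumBelow-neither n m A A')) ⟩
    ((S outside outside + S outside inside) + S inside outside) - (S outside outside + S outside inside)
      ≈⟨ xyx⁻¹≈y _ _ ⟩
    S inside outside
      ∎
    where
    S : Bool → Bool → Carrier
    S b b' = sumBelow R (slice m b b') A A'
  slice-isBiMobius mob inside inside ()

  isBiMobius⇒≈biMobius : ∀ {n} {g m : Subset n → Subset n → Carrier} → IsBiMobius R g m →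
                         ∀ A B → Disjoint A B → m A B ≈ biMobius g A B
  isBiMobius⇒≈biMobius mob []      []       d = sym (trans (mob [] [] d) (trans (+-identityʳ _) (+-identityʳ _)))
  isBiMobius⇒≈biMobius mob (b ∷ A) (b' ∷ B) d =
    isBiMobius⇒≈biMobius (slice-isBiMobius mob b b' (P.cong head d)) A B (P.cong tail d)

  firstDifference-cong : ∀ {n} {g h : Subset (suc n) → Subset (suc n) → Carrier} →
    (∀ A B → g A B ≈ h A B) → ∀ b b' A B → firstDifference g b b' A B ≈ firstDifference h b b' A B
  firstDifference-cong e inside  outside A B = -‿cong₂ (e _ _) (e _ _)
  firstDifference-cong e outside outside A B = -‿cong₂ (e _ _) (e _ _)
  firstDifference-cong e outside inside  A B = e _ _
  firstDifference-cong e inside  inside  A B = refl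

  biMobius-cong : ∀ {n} {g h : Subset n → Subset n → Carrier} →
                  (∀ A B → g A B ≈ h A B) → ∀ A B → biMobius g A B ≈ biMobius h A B
  biMobius-cong e []      []       = e [] []
  biMobius-cong e (b ∷ A) (b' ∷ B) = biMobius-cong (firstDifference-cong e b b') A B

  firstDifference-zero : ∀ {n} {g : Subset (suc n) → Subset (suc n) → Carrier} →
    (∀ A B → g A B ≈ 0#) → ∀ b b' A B → firstDifference g b b' A B ≈ 0#
  firstDifference-zero e inside  outside A B = trans (-‿cong₂ (e _ _) (e _ _)) (-‿inverseʳ 0#)
  firstDifference-zero e outside outside A B = trans (-‿cong₂ (e _ _) (e _ _)) (-‿inverseʳ 0#)
  firstDifference-zero e outside inside  A B = e _ _
  firstDifference-zero e inside  inside  A B = refl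

  biMobius-zero : ∀ {n} {g : Subset n → Subset n → Carrier} →
                  (∀ A B → g A B ≈ 0#) → ∀ A B → biMobius g A B ≈ 0#
  biMobius-zero e []      []       = e [] []
  biMobius-zero e (b ∷ A) (b' ∷ B) = biMobius-zero (firstDifference-zero e b b') A B

  firstDifference-+ : ∀ {n} (g h : Subset (suc n) → Subset (suc n) → Carrier) b b' A B →
    firstDifference (λ A B → g A B + h A B) b b' A B ≈ firstDifference g b b' A B + firstDifference h b b' A B
  firstDifference-+ g h inside  outside A B = -‿interchange _ _ _ _
  firstDifference-+ g h outside outside A B = -‿interchange _ _ _ _
  firstDifference-+ g h outside inside  A B = refl
  firstDifference-+ g h inside  inside  A B = sym (+-identityʳ 0#)

  biMobius-+ : ∀ {n} (g h : Subset n → Subset n → Carrier) A B →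
               biMobius (λ A B → g A B + h A B) A B ≈ biMobius g A B + biMobius h A B
  biMobius-+ g h []      []       = refl
  biMobius-+ g h (b ∷ A) (b' ∷ B) =
    trans (biMobius-cong (firstDifference-+ g h b b') A B)
          (biMobius-+ (firstDifference g b b') (firstDifference h b b') A B)

  biMobius-onFirst-diagonal : ∀ {n} (g : Subset n → Subset n → Carrier) (α : Subset n → Carrier) →
    (∀ A B → g A B ≈ α A) → ∀ A → biMobius g A (∁ A) ≈ mobius R α A
  biMobius-onFirst-diagonal g α e [] = trans (e [] []) (sym (mobius-[] α))
  biMobius-onFirst-diagonal g α e (inside ∷ A) =
    trans (biMobius-onFirst-diagonal _ (λ A → α (inside ∷ A) - α (outside ∷ A)) (λ A B → -‿cong₂ (e _ _) (e _ _)) A)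
          (sym (mobius-inside _ α A))
  biMobius-onFirst-diagonal g α e (outside ∷ A) =
    trans (biMobius-onFirst-diagonal _ (α ∘ (outside ∷_)) (λ A B → e _ _) A) (sym (mobius-outside _ α A))

  biMobius-onFirst-offDiagonal : ∀ {n} (g : Subset n → Subset n → Carrier) (α : Subset n → Carrier) →
    (∀ A B → g A B ≈ α A) → ∀ A B → ¬ B ≡ ∁ A → biMobius g A B ≈ 0#
  biMobius-onFirst-offDiagonal g α e [] [] B≢∁A = contradiction P.refl B≢∁A
  biMobius-onFirst-offDiagonal g α e (inside ∷ A) (outside ∷ B) B≢∁A =
    biMobius-onFirst-offDiagonal _ (λ A → α (inside ∷ A) - α (outside ∷ A)) (λ A B → -‿cong₂ (e _ _) (e _ _))
      A B (B≢∁A ∘ P.cong (outside ∷_))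
  biMobius-onFirst-offDiagonal g α e (outside ∷ A) (outside ∷ B) B≢∁A =
    biMobius-zero (λ A B → trans (-‿cong₂ (e _ _) (e _ _)) (-‿inverseʳ _)) A B
  biMobius-onFirst-offDiagonal g α e (outside ∷ A) (inside ∷ B) B≢∁A =
    biMobius-onFirst-offDiagonal _ (α ∘ (outside ∷_)) (λ A B → e _ _) A B (B≢∁A ∘ P.cong (inside ∷_))
  biMobius-onFirst-offDiagonal g α e (inside ∷ A) (inside ∷ B) B≢∁A = biMobius-zero (λ _ _ → refl) A B

  biMobius-onSecond-bottom : ∀ {n} (g : Subset n → Subset n → Carrier) (β : Subset n → Carrier) →
    (∀ A B → g A B ≈ β B) → ∀ B → biMobius g ⊥ B ≈ mobius R (β ∘ ∁) (∁ B)
  biMobius-onSecond-bottom g β e [] = trans (e [] []) (sym (mobius-[] (β ∘ ∁)))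
  biMobius-onSecond-bottom g β e (outside ∷ B) =
    trans (biMobius-onSecond-bottom _ (λ B → β (outside ∷ B) - β (inside ∷ B)) (λ A B → -‿cong₂ (e _ _) (e _ _)) B)
          (sym (mobius-inside _ (β ∘ ∁) (∁ B)))
  biMobius-onSecond-bottom g β e (inside ∷ B) =
    trans (biMobius-onSecond-bottom _ (β ∘ (inside ∷_)) (λ A B → e _ _) B)
          (sym (mobius-outside _ (β ∘ ∁) (∁ B)))

  biMobius-onSecond-nonBottom : ∀ {n} (g : Subset n → Subset n → Carrier) (β : Subset n → Carrier) →
    (∀ A B → g A B ≈ β B) → ∀ A B → ¬ A ≡ ⊥ → biMobius g A B ≈ 0#
  biMobius-onSecond-nonBottom g β e [] [] A≢⊥ = contradiction P.refl A≢⊥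
  biMobius-onSecond-nonBottom g β e (inside ∷ A) (outside ∷ B) A≢⊥ =
    biMobius-zero (λ A B → trans (-‿cong₂ (e _ _) (e _ _)) (-‿inverseʳ _)) A B
  biMobius-onSecond-nonBottom g β e (outside ∷ A) (outside ∷ B) A≢⊥ =
    biMobius-onSecond-nonBottom _ (λ B → β (outside ∷ B) - β (inside ∷ B)) (λ A B → -‿cong₂ (e _ _) (e _ _))
      A B (A≢⊥ ∘ P.cong (outside ∷_))
  biMobius-onSecond-nonBottom g β e (outside ∷ A) (inside ∷ B) A≢⊥ =
    biMobius-onSecond-nonBottom _ (β ∘ (inside ∷_)) (λ A B → e _ _) A B (A≢⊥ ∘ P.cong (outside ∷_))
  biMobius-onSecond-nonBottom g β e (inside ∷ A) (inside ∷ B) A≢⊥ = biMobius-zero (λ _ _ → refl) A B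

proposition1 : {c ℓ ℓ' : Level} (R : CommutativeRing c ℓ)
    → let open CommutativeRing R in
    (_≤_ : Carrier → Carrier → Set ℓ')
    → (n : ℕ) (ν₁ ν₂ : Subset n → Carrier)
    → IsCapacity R _≤_ ν₁ → IsCapacity R _≤_ ν₂
    → (m : Subset n → Subset n → Carrier)
    → IsBiMobius R (λ A B → ν₁ A - ν₂ B) m
    → (∀ A → ¬ (A ≡ ⊥) → m A (∁ A) ≈ mobius R ν₁ A)
    × (∀ B → ¬ (B ≡ ⊤) → m ⊥ B ≈ mobius R (conjugate R ν₂) (∁ B))
    × (m ⊥ ⊤ ≈ - 1#)
    × (∀ A B → Disjoint A B → ¬ (A ≡ ⊥) → ¬ (B ≡ ∁ A) → m A B ≈ 0#)
proposition1 R _≤_ n ν₁ ν₂ cap₁ cap₂ m mob = diagonal , bottom , bottom-top , elsewhere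
  where
  open CommutativeRing R
  open BiMobius R
  open IsCapacity
  open SetoidReasoning setoid

  first second : Subset n → Subset n → Carrier
  first  A B = ν₁ A
  second A B = - ν₂ B

  m≈ : ∀ A B → Disjoint A B → m A B ≈ biMobius first A B + biMobius second A B
  m≈ A B d = trans (isBiMobius⇒≈biMobius mob A B d) (biMobius-+ first second A B)

  diagonal : ∀ A → ¬ A ≡ ⊥ → m A (∁ A) ≈ mobius R ν₁ A
  diagonal A A≢⊥ = trans (m≈ A (∁ A) (∩-inverseʳ A))
    (trans (+-cong (biMobius-onFirst-diagonal first ν₁ (λ _ _ → refl) A)
                   (biMobius-onSecond-nonBottom second (-_ ∘ ν₂) (λ _ _ → refl) A (∁ A) A≢⊥))
           (+-identityʳ _))

  -- Besides the conjugation, ν̄₂ = 1 - ν₂∘∁ differs from -ν₂∘∁ by a constant.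
  bottom : ∀ B → ¬ B ≡ ⊤ → m ⊥ B ≈ mobius R (conjugate R ν₂) (∁ B)
  bottom B B≢⊤ = trans (m≈ ⊥ B (∩-zeroˡ B))
    (trans (+-cong (biMobius-onFirst-offDiagonal first ν₁ (λ _ _ → refl) ⊥ B (B≢⊤ ∘ (λ q → P.trans q (∁⊥≡⊤ n))))
                   (biMobius-onSecond-bottom second (-_ ∘ ν₂) (λ _ _ → refl) B))
    (trans (+-identityˡ _) (sym (mobius-shift n 1# (-_ ∘ ν₂ ∘ ∁) (∁ B) ∁B≢⊥))))
    where
    ∁B≢⊥ : ¬ ∁ B ≡ ⊥
    ∁B≢⊥ q = B≢⊤ (P.trans (P.sym (∁-involutive B)) (P.trans (P.cong ∁ q) (∁⊥≡⊤ n)))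

  bottom-top : m ⊥ ⊤ ≈ - 1#
  bottom-top = trans (m≈ ⊥ ⊤ (∩-zeroˡ ⊤)) (trans (+-cong first-part second-part) (+-identityˡ _))
    where
    first-part : biMobius first ⊥ ⊤ ≈ 0#
    first-part = begin
      biMobius first ⊥ ⊤       ≡⟨ P.cong (biMobius first ⊥) (∁⊥≡⊤ n) ⟨
      biMobius first ⊥ (∁ ⊥)   ≈⟨ biMobius-onFirst-diagonal first ν₁ (λ _ _ → refl) ⊥ ⟩
      mobius R ν₁ ⊥           ≈⟨ mobius-⊥ n ν₁ ⟩
      ν₁ ⊥                    ≈⟨ empty cap₁ ⟩
      0#                      ∎
    second-part : biMobius second ⊥ ⊤ ≈ - 1#
    second-part = begin
      biMobius second ⊥ ⊤            ≈⟨ biMobius-onSecond-bottom second (-_ ∘ ν₂) (λ _ _ → refl) ⊤ ⟩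
      mobius R (-_ ∘ ν₂ ∘ ∁) (∁ ⊤)   ≡⟨ P.cong (mobius R (-_ ∘ ν₂ ∘ ∁)) (∁⊤≡⊥ n) ⟩
      mobius R (-_ ∘ ν₂ ∘ ∁) ⊥       ≈⟨ mobius-⊥ n (-_ ∘ ν₂ ∘ ∁) ⟩
      - ν₂ (∁ ⊥)                     ≡⟨ P.cong (-_ ∘ ν₂) (∁⊥≡⊤ n) ⟩
      - ν₂ ⊤                         ≈⟨ -‿cong (full cap₂) ⟩
      - 1#                           ∎

  elsewhere : ∀ A B → Disjoint A B → ¬ A ≡ ⊥ → ¬ B ≡ ∁ A → m A B ≈ 0#
  elsewhere A B d A≢⊥ B≢∁A = trans (m≈ A B d)
    (trans (+-cong (biMobius-onFirst-offDiagonal first ν₁ (λ _ _ → refl) A B B≢∁A)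
                   (biMobius-onSecond-nonBottom second (-_ ∘ ν₂) (λ _ _ → refl) A B A≢⊥))
           (+-identityʳ 0#))
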